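{- Let $\mathcal{F}\subseteq\binom{[n]}{k}$ be a $t$-intersecting family and $S$ an $s$-subset of $[n]$ with $t-1\leq s\leq k$. If there exists $F'\in\mathcal{F}$ such that $|S\cap F'|=r\leq t-1$, then $|\mathcal{F}_S|\leq\binom{k-r}{t-r}\binom{n-s-t+r}{k-s-t+r}$.
   Context: $\binom{[n]}{k}$ is the family of $k$-subsets of $[n]=\{1,\ldots,n\}$. $\mathcal{F}$ is $t$-intersecting if $|A\cap B|\geq t$ for all $A,B\in\mathcal{F}$. For a subset $S\subseteq[n]$, $\mathcal{F}_S=\{F\in\mathcal{F}: S\subseteq F\}$. Binomial coefficients $\binom{a}{b}$ with $b<0$ are $0$. -}

module Defs where

open import Data.Nat using (ℕ; _≤_)
open import Data.Nat.Combinatorics using (_C_)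
open import Data.Integer using (ℤ; +_; -[1+_])
open import Data.List using (List; filter)
open import Data.List.Membership.Propositional using (_∈_)
open import Data.Fin.Subset using (Subset; _⊆_; _∩_; ∣_∣)
open import Data.Fin.Subset.Properties using (_⊆?_)
open import Relation.Binary.PropositionalEquality using (_≡_)

-- A family of subsets of [n] = Fin n, given as a list of subsets
-- (distinctness is imposed separately via Unique).
Family : ℕ → Set
Family n = List (Subset n)

Uniform : ∀ {n} → ℕ → Family n → Set
Uniform k 𝓕 = ∀ {A} → A ∈ 𝓕 → ∣ A ∣ ≡ k

TIntersecting : ∀ {n} → ℕ → Family n → Set
TIntersecting t 𝓕 = ∀ {A B} → A ∈ 𝓕 → B ∈ 𝓕 → t ≤ ∣ A ∩ B ∣

star : ∀ {n} → Family n → Subset n → Family n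
star 𝓕 S = filter (S ⊆?_) 𝓕

-- Binomial coefficient with integer arguments; 0 whenever an argument is
-- negative (the paper's convention: binom(a,b) = 0 for b < 0; in the
-- statement a negative top argument only occurs together with b < 0).
binomℤ : ℤ → ℤ → ℕ
binomℤ (+ a) (+ b) = a C b
binomℤ (+ a) -[1+ b ] = 0
binomℤ -[1+ a ] _ = 0

module Submission where

-- Fix G ∈ 𝓕 with |S ∩ G| = r.  Every F ∈ 𝓕_S is a k-set
-- containing S, and since |F ∩ G| ≥ t it has at least t − r points in G ∖ S.
-- So 𝓕_S is a repetition-free list all of whose members occur in an explicit
-- list of "candidates": the sets F ⊇ S with |F| = |S| + c having at least m
-- points in G ∖ S (here c = k − s, m = t − r), built one coordinate at a time.
-- Hence |𝓕_S| is at most the length of the candidate list, and by induction on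
-- the coordinates, with Pascal-type inequalities, that length is at most
--   C(a, m) · C(a + b − m, c − m),   a = |G ∖ S| = k − r,  b = |[n] ∖ (S ∪ G)|.
-- Finally this closed form equals the integer-indexed binomials of the
-- statement (and vanishes when c < m).

open import Defs
open import Data.Bool using (true; false)
open import Data.Nat using (ℕ; zero; suc; _≤_; _<_; _+_; _*_; _∸_; z≤n; s≤s)
open import Data.Nat.Properties
open import Data.Nat.Combinatorics using (_C_; k>n⇒nCk≡0)
  renaming (nCk+nC[k+1]≡[n+1]C[k+1] to pascal)
open import Data.Integer using (+_) renaming (_+_ to _+ℤ_; _-_ to _-ℤ_)
open import Data.Integer.Properties using (pos-+; m-n≡m⊖n; ⊖-≥)
open import Data.Integer.Solver using (module +-*-Solver)
open import Data.Product using (Σ; _×_; _,_; map₁)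
open import Data.Empty using (⊥-elim)
open import Data.List using (List; []; _∷_; _++_; [_]; length; map)
open import Data.List.Properties using (length-map; length-++)
open import Data.List.Membership.Propositional using (_∈_)
open import Data.List.Membership.Propositional.Properties
  using (∈-map⁺; ∈-++⁺ˡ; ∈-++⁺ʳ; ∈-++⁻; ∈-filter⁻; ∈-∃++)
open import Data.List.Relation.Unary.Any using (here; there)
open import Data.List.Relation.Unary.All using (lookup)
open import Data.List.Relation.Unary.AllPairs using (_∷_)
open import Data.List.Relation.Unary.Unique.Propositional using (Unique)
open import Data.List.Relation.Unary.Unique.Propositional.Properties using (filter⁺)
open import Data.Sum using (inj₁; inj₂)
open import Data.Vec using ([]; _∷_)
import Data.Vec as Vec
open import Data.Fin.Subset using (Subset; _⊆_; _∩_; _∪_; _─_; ∁; ∣_∣)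
open import Data.Fin.Subset.Properties
  using (_⊆?_; p⊆q⇒∣p∣≤∣q∣; drop-∷-⊆; ∣p∣≤n; x∈p∩q⁺; x∈p∩q⁻)
open import Relation.Nullary using (¬_; yes; no)
open import Relation.Binary.PropositionalEquality
  using (_≡_; refl; sym; trans; cong; cong₂; subst; module ≡-Reasoning)

length-insert : ∀ {A : Set} (ys : List A) x zs →
                length (ys ++ x ∷ zs) ≡ suc (length (ys ++ zs))
length-insert []       x zs = refl
length-insert (y ∷ ys) x zs = cong suc (length-insert ys x zs)

unique-⊆-length : ∀ {A : Set} (xs ys : List A) → Unique xs →
                  (∀ {z} → z ∈ xs → z ∈ ys) → length xs ≤ length ys
unique-⊆-length []       ys _              _      = z≤n
unique-⊆-length (x ∷ xs) ys (x∉xs ∷ uniq) xs⊆ys with ∈-∃++ (xs⊆ys (here refl))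
... | ys₁ , ys₂ , refl =
  subst (suc (length xs) ≤_) (sym (length-insert ys₁ x ys₂))
        (s≤s (unique-⊆-length xs (ys₁ ++ ys₂) uniq xs⊆ys₁++ys₂))
  where
  -- x itself is removed from ys; the other members of xs differ from x.
  xs⊆ys₁++ys₂ : ∀ {z} → z ∈ xs → z ∈ ys₁ ++ ys₂
  xs⊆ys₁++ys₂ z∈xs with ∈-++⁻ ys₁ (xs⊆ys (there z∈xs))
  ... | inj₁ z∈ys₁         = ∈-++⁺ˡ z∈ys₁
  ... | inj₂ (here z≡x)    = ⊥-elim (lookup x∉xs z∈xs (sym z≡x))
  ... | inj₂ (there z∈ys₂) = ∈-++⁺ʳ ys₁ z∈ys₂

-- Binomial coefficients increase with the top argument (needed because the
-- bound only over-approximates the pool of remaining points).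
C-step : ∀ x k → x C k ≤ suc x C k
C-step x zero    = ≤-refl
C-step x (suc k) = subst (x C suc k ≤_) (pascal x k) (m≤n+m (x C suc k) (x C k))

C-monoˡ : ∀ k {x y} → x ≤ y → x C k ≤ y C k
C-monoˡ k {y = zero}  z≤n = ≤-refl
C-monoˡ k {y = suc y} x≤1+y with m≤n⇒m<n∨m≡n x≤1+y
... | inj₁ (s≤s x≤y) = ≤-trans (C-monoˡ k x≤y) (C-step y k)
... | inj₂ refl      = ≤-refl

-- binom∸ x c m = x C (c − m) if m ≤ c, and 0 if c < m: the number of ways to
-- complete m already chosen points to a c-set using a pool of x further points.
binom∸ : ℕ → ℕ → ℕ → ℕ
binom∸ x c       zero    = x C c
binom∸ x zero    (suc m) = 0
binom∸ x (suc c) (suc m) = binom∸ x c m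

binom∸-≤ : ∀ x {c m} → m ≤ c → binom∸ x c m ≡ x C (c ∸ m)
binom∸-≤ x {m = zero}  _         = refl
binom∸-≤ x {m = suc m} (s≤s m≤c) = binom∸-≤ x m≤c

binom∸-> : ∀ x {c m} → c < m → binom∸ x c m ≡ 0
binom∸-> x {zero}  {suc m} _         = refl
binom∸-> x {suc c} {suc m} (s≤s c<m) = binom∸-> x c<m

binom∸-monoˡ : ∀ c m {x y} → x ≤ y → binom∸ x c m ≤ binom∸ y c m
binom∸-monoˡ c       zero    x≤y = C-monoˡ c x≤y
binom∸-monoˡ zero    (suc m) x≤y = z≤n
binom∸-monoˡ (suc c) (suc m) x≤y = binom∸-monoˡ c m x≤y

binom∸-pascal : ∀ x c m → binom∸ x c m + binom∸ x (suc c) m ≡ binom∸ (suc x) (suc c) m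
binom∸-pascal x c       zero          = pascal x c
binom∸-pascal x zero    (suc zero)    = refl
binom∸-pascal x zero    (suc (suc m)) = refl
binom∸-pascal x (suc c) (suc m)       = binom∸-pascal x c m

-- overcount a b c m bounds the number of c-subsets of an (a + b)-set A ⊎ B
-- (|A| = a) with at least m points in A: choose m points of A, then the rest.
overcount : ℕ → ℕ → ℕ → ℕ → ℕ
overcount a b c m = (a C m) * binom∸ (a + b ∸ m) c m

overcount-monoʳ : ∀ a b c m → overcount a b c m ≤ overcount a (suc b) c m
overcount-monoʳ a b c m =
  *-monoʳ-≤ (a C m) (binom∸-monoˡ c m (∸-monoˡ-≤ m (+-monoʳ-≤ a (n≤1+n b))))

overcount-monoˡ : ∀ a b c m → overcount a b c m ≤ overcount (suc a) b c m
overcount-monoˡ a b c m =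
  *-mono-≤ (C-step a m) (binom∸-monoˡ c m (∸-monoˡ-≤ m (n≤1+n (a + b))))

-- Adding a point to B: the sets avoiding it plus the sets containing it.
overcount-pascalʳ : ∀ a b c m →
  overcount a b c m + overcount a b (suc c) m ≤ overcount a (suc b) (suc c) m
overcount-pascalʳ a b c m with m ≤? a
... | no m≰a rewrite k>n⇒nCk≡0 (≰⇒> m≰a) = z≤n
... | yes m≤a = begin
    (a C m) * binom∸ x c m + (a C m) * binom∸ x (suc c) m
      ≡⟨ sym (*-distribˡ-+ (a C m) _ _) ⟩
    (a C m) * (binom∸ x c m + binom∸ x (suc c) m)
      ≡⟨ cong ((a C m) *_) (binom∸-pascal x c m) ⟩
    (a C m) * binom∸ (suc x) (suc c) m
      ≡⟨ cong (λ z → (a C m) * binom∸ z (suc c) m) (sym pool) ⟩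
    (a C m) * binom∸ (a + suc b ∸ m) (suc c) m ∎
  where
  open ≤-Reasoning
  x = a + b ∸ m
  pool : a + suc b ∸ m ≡ suc x
  pool = trans (cong (_∸ m) (+-suc a b)) (+-∸-assoc 1 (≤-trans m≤a (m≤m+n a b)))

-- Adding a point to A: if it is chosen, only m − 1 more points of A are needed.
overcount-pascalˡ : ∀ a b c m →
  overcount a b c (m ∸ 1) + overcount a b (suc c) m ≤ overcount (suc a) b (suc c) m
overcount-pascalˡ a b c zero = ≤-reflexive (begin
    1 * ((a + b) C c) + 1 * ((a + b) C suc c)
      ≡⟨ cong₂ _+_ (*-identityˡ ((a + b) C c)) (*-identityˡ ((a + b) C suc c)) ⟩
    (a + b) C c + (a + b) C suc c
      ≡⟨ pascal (a + b) c ⟩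
    suc (a + b) C suc c
      ≡⟨ sym (*-identityˡ (suc (a + b) C suc c)) ⟩
    1 * (suc (a + b) C suc c) ∎)
  where open ≡-Reasoning
overcount-pascalˡ a b c (suc m) = begin
    (a C m) * binom∸ (a + b ∸ m) c m + (a C suc m) * binom∸ (a + b ∸ suc m) c m
      ≤⟨ +-monoʳ-≤ ((a C m) * _)
           (*-monoʳ-≤ (a C suc m) (binom∸-monoˡ c m (∸-monoʳ-≤ (a + b) (n≤1+n m)))) ⟩
    (a C m) * binom∸ (a + b ∸ m) c m + (a C suc m) * binom∸ (a + b ∸ m) c m
      ≡⟨ sym (*-distribʳ-+ (binom∸ (a + b ∸ m) c m) (a C m) (a C suc m)) ⟩
    (a C m + a C suc m) * binom∸ (a + b ∸ m) c m
      ≡⟨ cong (_* binom∸ (a + b ∸ m) c m) (pascal a m) ⟩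
    (suc a C suc m) * binom∸ (a + b ∸ m) c m ∎
  where open ≤-Reasoning

-- candidates S G c m lists the sets F ⊇ S with |F| = |S| + c having at least
-- m points in G ∖ S, deciding one coordinate at a time ("at least m" is kept
-- by counting m down to 0 whenever a point of G ∖ S is taken).
candidates : ∀ {n} → Subset n → Subset n → ℕ → ℕ → List (Subset n)
candidates []          []          zero    zero = [ [] ]
candidates []          []          _       _    = []
candidates (true ∷ S)  (_ ∷ G)     c       m    = map (true ∷_) (candidates S G c m)
candidates (false ∷ S) (_ ∷ G)     zero    m    = map (false ∷_) (candidates S G zero m)
candidates (false ∷ S) (true ∷ G)  (suc c) m    =
  map (true ∷_) (candidates S G c (m ∸ 1)) ++ map (false ∷_) (candidates S G (suc c) m)
candidates (false ∷ S) (false ∷ G) (suc c) m    =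
  map (true ∷_) (candidates S G c m) ++ map (false ∷_) (candidates S G (suc c) m)

inside∷⊈outside∷ : ∀ {n} {p q : Subset n} → ¬ (true ∷ p ⊆ false ∷ q)
inside∷⊈outside∷ sub with sub Vec.here
... | ()

no-new-point : ∀ {n} {S F : Subset n} → S ⊆ F → ¬ (suc ∣ F ∣ ≡ ∣ S ∣ + 0)
no-new-point {S = S} S⊆F eq =
  <⇒≢ (s≤s (p⊆q⇒∣p∣≤∣q∣ S⊆F)) (sym (trans eq (+-identityʳ ∣ S ∣)))

∩-monoˡ-∣∣ : ∀ {n} {S F : Subset n} (G : Subset n) → S ⊆ F → ∣ S ∩ G ∣ ≤ ∣ F ∩ G ∣
∩-monoˡ-∣∣ {S = S} G S⊆F =
  p⊆q⇒∣p∣≤∣q∣ λ x∈S∩G → x∈p∩q⁺ (map₁ S⊆F (x∈p∩q⁻ S G x∈S∩G))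

-- Taking one point of G ∖ S lowers the number still required by one.
required-after-taking : ∀ m {x y} → x ≤ y → m + x ≤ suc y → m ∸ 1 + x ≤ y
required-after-taking zero    x≤y _       = x≤y
required-after-taking (suc m) _   m+x≤1+y = ≤-pred m+x≤1+y

candidates-complete : ∀ {n} (S G F : Subset n) c m → S ⊆ F → ∣ F ∣ ≡ ∣ S ∣ + c →
                      m + ∣ S ∩ G ∣ ≤ ∣ F ∩ G ∣ → F ∈ candidates S G c m
candidates-complete [] [] [] zero    zero    _ _ _  = here refl
candidates-complete [] [] [] zero    (suc m) _ _ ()
candidates-complete [] [] [] (suc c) m       _ () _
candidates-complete (true ∷ S) _ (false ∷ F) c m S⊆F _ _ = ⊥-elim (inside∷⊈outside∷ S⊆F)
candidates-complete (true ∷ S) (true ∷ G) (true ∷ F) c m S⊆F size trace =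
  ∈-map⁺ _ (candidates-complete S G F c m (drop-∷-⊆ S⊆F) (suc-injective size)
    (≤-pred (subst (_≤ suc ∣ F ∩ G ∣) (+-suc m ∣ S ∩ G ∣) trace)))
candidates-complete (true ∷ S) (false ∷ G) (true ∷ F) c m S⊆F size trace =
  ∈-map⁺ _ (candidates-complete S G F c m (drop-∷-⊆ S⊆F) (suc-injective size) trace)
candidates-complete (false ∷ S) (_ ∷ G) (true ∷ F) zero m S⊆F size _ =
  ⊥-elim (no-new-point (drop-∷-⊆ S⊆F) size)
candidates-complete (false ∷ S) (_ ∷ G) (false ∷ F) zero m S⊆F size trace =
  ∈-map⁺ _ (candidates-complete S G F zero m (drop-∷-⊆ S⊆F) size trace)
candidates-complete (false ∷ S) (true ∷ G) (true ∷ F) (suc c) m S⊆F size trace =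
  ∈-++⁺ˡ (∈-map⁺ _ (candidates-complete S G F c (m ∸ 1) (drop-∷-⊆ S⊆F)
    (suc-injective (trans size (+-suc ∣ S ∣ c)))
    (required-after-taking m (∩-monoˡ-∣∣ G (drop-∷-⊆ S⊆F)) trace)))
candidates-complete (false ∷ S) (false ∷ G) (true ∷ F) (suc c) m S⊆F size trace =
  ∈-++⁺ˡ (∈-map⁺ _ (candidates-complete S G F c m (drop-∷-⊆ S⊆F)
    (suc-injective (trans size (+-suc ∣ S ∣ c))) trace))
candidates-complete (false ∷ S) (true ∷ G) (false ∷ F) (suc c) m S⊆F size trace =
  ∈-++⁺ʳ _ (∈-map⁺ _ (candidates-complete S G F (suc c) m (drop-∷-⊆ S⊆F) size trace))
candidates-complete (false ∷ S) (false ∷ G) (false ∷ F) (suc c) m S⊆F size trace =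
  ∈-++⁺ʳ _ (∈-map⁺ _ (candidates-complete S G F (suc c) m (drop-∷-⊆ S⊆F) size trace))

length-branches : ∀ {n} (xs ys : List (Subset n)) →
  length (map (true ∷_) xs ++ map (false ∷_) ys) ≡ length xs + length ys
length-branches xs ys = trans (length-++ (map (true ∷_) xs))
  (cong₂ _+_ (length-map (true ∷_) xs) (length-map (false ∷_) ys))

candidates-length : ∀ {n} (S G : Subset n) c m →
  length (candidates S G c m) ≤ overcount ∣ G ─ S ∣ ∣ ∁ (S ∪ G) ∣ c m
candidates-length [] [] zero    zero    = ≤-refl
candidates-length [] [] zero    (suc m) = z≤n
candidates-length [] [] (suc c) m       = z≤n
candidates-length (true ∷ S) (_ ∷ G) c m =
  ≤-trans (≤-reflexive (length-map (true ∷_) (candidates S G c m)))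
          (candidates-length S G c m)
candidates-length (false ∷ S) (true ∷ G) zero m =
  ≤-trans (≤-reflexive (length-map (false ∷_) (candidates S G zero m)))
  (≤-trans (candidates-length S G zero m) (overcount-monoˡ _ _ zero m))
candidates-length (false ∷ S) (false ∷ G) zero m =
  ≤-trans (≤-reflexive (length-map (false ∷_) (candidates S G zero m)))
  (≤-trans (candidates-length S G zero m) (overcount-monoʳ _ _ zero m))
candidates-length (false ∷ S) (true ∷ G) (suc c) m =
  ≤-trans (≤-reflexive (length-branches (candidates S G c (m ∸ 1)) _))
  (≤-trans (+-mono-≤ (candidates-length S G c (m ∸ 1)) (candidates-length S G (suc c) m))
           (overcount-pascalˡ _ _ c m))
candidates-length (false ∷ S) (false ∷ G) (suc c) m =
  ≤-trans (≤-reflexive (length-branches (candidates S G c m) _))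
  (≤-trans (+-mono-≤ (candidates-length S G c m) (candidates-length S G (suc c) m))
           (overcount-pascalʳ _ _ c m))

∣─∣+∣∩∣ : ∀ {n} (S G : Subset n) → ∣ G ─ S ∣ + ∣ S ∩ G ∣ ≡ ∣ G ∣
∣─∣+∣∩∣ []          []         = refl
∣─∣+∣∩∣ (true ∷ S)  (true ∷ G) = trans (+-suc ∣ G ─ S ∣ _) (cong suc (∣─∣+∣∩∣ S G))
∣─∣+∣∩∣ (true ∷ S)  (false ∷ G) = ∣─∣+∣∩∣ S G
∣─∣+∣∩∣ (false ∷ S) (true ∷ G) = cong suc (∣─∣+∣∩∣ S G)
∣─∣+∣∩∣ (false ∷ S) (false ∷ G) = ∣─∣+∣∩∣ S G

partition-size : ∀ {n} (S G : Subset n) → ∣ G ─ S ∣ + ∣ ∁ (S ∪ G) ∣ + ∣ S ∣ ≡ n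
partition-size []          []          = refl
partition-size (true ∷ S)  (_ ∷ G)     =
  trans (+-suc (∣ G ─ S ∣ + ∣ ∁ (S ∪ G) ∣) _) (cong suc (partition-size S G))
partition-size (false ∷ S) (true ∷ G)  = cong suc (partition-size S G)
partition-size (false ∷ S) (false ∷ G) =
  trans (cong (_+ ∣ S ∣) (+-suc ∣ G ─ S ∣ _)) (cong suc (partition-size S G))

-ℤ-as-∸ : ∀ {x y} → y ≤ x → + x -ℤ + y ≡ + (x ∸ y)
-ℤ-as-∸ {x} {y} y≤x = trans (m-n≡m⊖n x y) (⊖-≥ y≤x)

cancel-shift : ∀ e d r → (+ (e + d) -ℤ + (d + r)) +ℤ + r ≡ + e
cancel-shift e d r rewrite pos-+ e d | pos-+ d r =
  solve 3 (λ E D R → (E :+ D :- (D :+ R)) :+ R := E) refl (+ e) (+ d) (+ r)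
  where open +-*-Solver

shift-as-ℕ : ∀ {x y t r} → y ≤ x → r ≤ t → t ∸ r ≤ x ∸ y →
             ((+ x -ℤ + y) -ℤ + t) +ℤ + r ≡ + ((x ∸ y) ∸ (t ∸ r))
shift-as-ℕ {x} {y} {t} {r} y≤x r≤t d≤u = begin
  ((+ x -ℤ + y) -ℤ + t) +ℤ + r
    ≡⟨ cong (λ z → (z -ℤ + t) +ℤ + r) (-ℤ-as-∸ y≤x) ⟩
  (+ u -ℤ + t) +ℤ + r
    ≡⟨ cong₂ (λ p q → (+ p -ℤ + q) +ℤ + r) (sym (m∸n+n≡m d≤u)) (sym (m∸n+n≡m r≤t)) ⟩
  (+ ((u ∸ d) + d) -ℤ + (d + r)) +ℤ + r
    ≡⟨ cancel-shift (u ∸ d) d r ⟩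
  + (u ∸ d) ∎
  where
  open ≡-Reasoning
  u = x ∸ y
  d = t ∸ r

overcount-as-binomℤ : ∀ {n k t s r} a b → a + r ≡ k → a + b + s ≡ n →
  s ≤ k → r ≤ t → k ≤ n →
  overcount a b (k ∸ s) (t ∸ r)
    ≤ binomℤ (+ (k ∸ r)) (+ (t ∸ r))
      * binomℤ (((+ n -ℤ + s) -ℤ + t) +ℤ + r) (((+ k -ℤ + s) -ℤ + t) +ℤ + r)
overcount-as-binomℤ {n} {k} {t} {s} {r} a b a+r≡k a+b+s≡n s≤k r≤t k≤n
  with (t ∸ r) ≤? (k ∸ s)
... | no m≰c rewrite binom∸-> (a + b ∸ (t ∸ r)) (≰⇒> m≰c) | *-zeroʳ (a C (t ∸ r)) = z≤n
... | yes m≤c = ≤-reflexive (cong₂ _*_ (cong (_C (t ∸ r)) a≡k∸r) rest)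
  where
  open ≡-Reasoning
  a≡k∸r : a ≡ k ∸ r
  a≡k∸r = trans (sym (m+n∸n≡m a r)) (cong (_∸ r) a+r≡k)
  a+b≡n∸s : a + b ≡ n ∸ s
  a+b≡n∸s = trans (sym (m+n∸n≡m (a + b) s)) (cong (_∸ s) a+b+s≡n)
  rest : binom∸ (a + b ∸ (t ∸ r)) (k ∸ s) (t ∸ r)
       ≡ binomℤ (((+ n -ℤ + s) -ℤ + t) +ℤ + r) (((+ k -ℤ + s) -ℤ + t) +ℤ + r)
  rest = begin
    binom∸ (a + b ∸ (t ∸ r)) (k ∸ s) (t ∸ r)
      ≡⟨ binom∸-≤ _ m≤c ⟩
    (a + b ∸ (t ∸ r)) C ((k ∸ s) ∸ (t ∸ r))
      ≡⟨ cong (λ z → (z ∸ (t ∸ r)) C ((k ∸ s) ∸ (t ∸ r))) a+b≡n∸s ⟩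
    binomℤ (+ ((n ∸ s) ∸ (t ∸ r))) (+ ((k ∸ s) ∸ (t ∸ r)))
      ≡⟨ sym (cong₂ binomℤ (shift-as-ℕ (≤-trans s≤k k≤n) r≤t (≤-trans m≤c (∸-monoˡ-≤ s k≤n)))
                           (shift-as-ℕ s≤k r≤t m≤c)) ⟩
    binomℤ (((+ n -ℤ + s) -ℤ + t) +ℤ + r) (((+ k -ℤ + s) -ℤ + t) +ℤ + r) ∎

-- Every member of 𝓕_S is a candidate: it has |S| + (k − s) points and, meeting
-- G in at least t = (t − r) + r points, at least t − r points of G ∖ S.
star-⊆-candidates : ∀ {n k t s r} (𝓕 : Family n) (S G : Subset n) →
  Uniform k 𝓕 → TIntersecting t 𝓕 → G ∈ 𝓕 → ∣ S ∩ G ∣ ≡ r → r ≤ t →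
  ∣ S ∣ ≡ s → s ≤ k → ∀ {F} → F ∈ star 𝓕 S → F ∈ candidates S G (k ∸ s) (t ∸ r)
star-⊆-candidates {k = k} {t} {s} {r} 𝓕 S G uniform intersecting G∈𝓕 ∣S∩G∣≡r r≤t ∣S∣≡s s≤k
                  {F} F∈𝓕_S
  with ∈-filter⁻ (S ⊆?_) {xs = 𝓕} F∈𝓕_S
... | F∈𝓕 , S⊆F = candidates-complete S G F _ _ S⊆F
  (trans (uniform F∈𝓕) (trans (sym (m+[n∸m]≡n s≤k)) (cong (_+ (k ∸ s)) (sym ∣S∣≡s))))
  (subst (_≤ ∣ F ∩ G ∣) (sym (trans (cong (λ q → (t ∸ r) + q) ∣S∩G∣≡r) (m∸n+n≡m r≤t)))
         (intersecting F∈𝓕 G∈𝓕))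

lemma3p2 : (n k t s r : ℕ) (𝓕 : Family n) (S : Subset n) →
    Unique 𝓕 → Uniform k 𝓕 → TIntersecting t 𝓕 →
    ∣ S ∣ ≡ s → t ∸ 1 ≤ s → s ≤ k →
    Σ (Subset n) (λ F′ → F′ ∈ 𝓕 × ∣ S ∩ F′ ∣ ≡ r) → r + 1 ≤ t →
    length (star 𝓕 S)
    ≤ binomℤ (+ (k ∸ r)) (+ (t ∸ r))
    * binomℤ (((+ n -ℤ + s) -ℤ + t) +ℤ + r) (((+ k -ℤ + s) -ℤ + t) +ℤ + r)
lemma3p2 n k t s r 𝓕 S unique uniform intersecting ∣S∣≡s _ s≤k (G , G∈𝓕 , ∣S∩G∣≡r) r<t =
  begin
    length (star 𝓕 S)
      ≤⟨ unique-⊆-length (star 𝓕 S) (candidates S G c m) (filter⁺ (S ⊆?_) unique)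
           (star-⊆-candidates 𝓕 S G uniform intersecting G∈𝓕 ∣S∩G∣≡r r≤t ∣S∣≡s s≤k) ⟩
    length (candidates S G c m)
      ≤⟨ candidates-length S G c m ⟩
    overcount ∣ G ─ S ∣ ∣ ∁ (S ∪ G) ∣ c m
      ≤⟨ overcount-as-binomℤ _ _ a+r≡k a+b+s≡n s≤k r≤t k≤n ⟩
    binomℤ (+ (k ∸ r)) (+ m)
      * binomℤ (((+ n -ℤ + s) -ℤ + t) +ℤ + r) (((+ k -ℤ + s) -ℤ + t) +ℤ + r) ∎
  where
  open ≤-Reasoning
  c = k ∸ s
  m = t ∸ r
  r≤t : r ≤ t
  r≤t = ≤-trans (m≤m+n r 1) r<t
  a+r≡k : ∣ G ─ S ∣ + r ≡ k
  a+r≡k = trans (cong (λ q → ∣ G ─ S ∣ + q) (sym ∣S∩G∣≡r)) (trans (∣─∣+∣∩∣ S G) (uniform G∈𝓕))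
  a+b+s≡n : ∣ G ─ S ∣ + ∣ ∁ (S ∪ G) ∣ + s ≡ n
  a+b+s≡n = trans (cong (λ q → ∣ G ─ S ∣ + ∣ ∁ (S ∪ G) ∣ + q) (sym ∣S∣≡s)) (partition-size S G)
  k≤n : k ≤ n
  k≤n = subst (_≤ n) (uniform G∈𝓕) (∣p∣≤n G)
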